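{- Let $G$ be a complete multi-partite graph of order $n$ with at least two partite sets. For any $1\le r\le n$ and any $S_0\in\mathcal{P}_r(G)$, we have $S_0\in\mathcal{P}^*_r(G)$ if and only if $$|E_G(S_0)|=\min_{S\in\mathcal{P}_r(G)}|E_G(S)|.$$
   Context: $\mathcal{P}_r(G)$ is the family of $r$-element subsets of $V(G)$. For $S\subseteq V(G)$, $E_G(S)$ is the set of edges incident with at least one vertex of $S$. $\mathcal{P}^*_r(G)$ is the family of all sets $S$ that can be output by the following greedy procedure (over all tie-breaking choices): start with $S=\emptyset$ and $G_1=G$; for $i=1,\dots,r$, choose a vertex $u$ of minimum degree in $G_i$, add $u$ to $S$, and set $G_{i+1}=G_i-u$. -}

module Defs where

open import Data.Nat using (ℕ; _≤_; _<ᵇ_)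
open import Data.Bool using (Bool; true; false; _∧_; _∨_; not; T)
open import Data.Fin using (Fin; toℕ)
open import Data.Fin.Properties using (_≟_)
open import Data.Fin.Subset using (Subset; _∈_; _-_; ⊤; ⊥; _∪_; ⁅_⁆)
open import Data.Vec using (lookup)
open import Data.List using (List; []; _∷_; length; filter; allFin; concatMap; map)
open import Data.Product using (Σ; _×_; ∃; ∃-syntax; _,_)
open import Relation.Nullary.Decidable using (⌊_⌋)
open import Relation.Binary.PropositionalEquality using (_≡_)

record Graph (n : ℕ) : Set where
  field
    adj    : Fin n → Fin n → Bool
    sym    : ∀ u v → adj u v ≡ adj v u
    irrefl : ∀ u → adj u u ≡ false
open Graph public

count : ∀ {n} → (Fin n → Bool) → ℕ
count {n} p = length (filter (λ v → T? (p v)) (allFin n))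
  where
  open import Data.Bool.Properties using (T?)

IsCompleteMultipartite : ∀ {n} → Graph n → Set
IsCompleteMultipartite {n} G =
  Σ ℕ λ k → (2 ≤ k) × Σ (Fin n → Fin k) λ c →
    (∀ (j : Fin k) → ∃[ u ] c u ≡ j) ×
    (∀ u v → adj G u v ≡ not ⌊ c u ≟ c v ⌋)

degIn : ∀ {n} → Graph n → Subset n → Fin n → ℕ
degIn G R u = count (λ v → lookup R v ∧ adj G u v)

edgesTouching : ∀ {n} → Graph n → Subset n → ℕ
edgesTouching {n} G S =
  length (filter (λ p → T? (pick p)) (concatMap (λ u → map (u ,_) (allFin n)) (allFin n)))
  where
  open import Data.Bool.Properties using (T?)
  open import Data.Product using (_×_)
  pick : Fin n × Fin n → Bool
  pick (u , v) = (toℕ u <ᵇ toℕ v) ∧ adj G u v ∧ (lookup S u ∨ lookup S v)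

data Greedy {n} (G : Graph n) : Subset n → List (Fin n) → Set where
  done : ∀ {R} → Greedy G R []
  step : ∀ {R u us} → u ∈ R →
         (∀ v → v ∈ R → degIn G R u ≤ degIn G R v) →
         Greedy G (R - u) us → Greedy G R (u ∷ us)

toSubset : ∀ {n} → List (Fin n) → Subset n
toSubset []       = ⊥
toSubset (u ∷ us) = ⁅ u ⁆ ∪ toSubset us

InPstar : ∀ {n} → Graph n → ℕ → Subset n → Set
InPstar {n} G r S =
  ∃[ us ] (length us ≡ r × Greedy G ⊤ us × toSubset us ≡ S)

-- Let c send each vertex to its part and, for a vertex set T, let m_T(j) count the
-- vertices of T in part j. Two vertices are adjacent exactly when they lie in different
-- parts, so counting ordered pairs gives 2|E(S)| + |V∖S|² = 2|E(G)| + Σ_j m_{V∖S}(j)²;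
-- among r-sets S, |E(S)| is thus minimal exactly when Σ_j m_T(j)² is minimal for the kept
-- set T = V∖S. In G[R] a vertex has minimum degree iff its part has the most vertices in R.
-- Call T balanced when m_T(c v) ≤ m_T(c u) + 1 for every deleted u and kept v. Deleting a
-- vertex of a largest part keeps a set balanced, so greedy outputs are balanced; a balanced
-- T minimises Σ m_T(j)² by discrete convexity, and a minimiser is balanced since otherwise
-- moving one vertex from an overfull part to an underfull one lowers the sum; finally the
-- deleted vertices of a balanced T can be removed greedily, always from a largest part.

module Submission where

open import Defs renaming (sym to adj-sym; irrefl to adj-irrefl)
open import Data.Nat using (ℕ; zero; suc; _+_; _*_; _∸_; _≤_; _<_; z≤n; s≤s; s≤s⁻¹; s<s; z<s; _<ᵇ_)
open import Data.Nat.Properties hiding (_≟_)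
open import Data.Nat.Tactic.RingSolver using (solve-∀)
open import Data.Bool using (Bool; true; false; _∧_; _∨_; not)
open import Data.Bool.Properties using (T?; ∨-comm)
open import Data.Fin using (Fin; zero; suc; toℕ)
open import Data.Fin.Properties using (_≟_; toℕ-injective)
open import Data.Fin.Subset
  using (Subset; inside; outside; ∣_∣; Nonempty; ⊥; _∈_; _∉_; _⊆_; _-_; _─_; _∪_; ∁; ⊤; ⁅_⁆)
open import Data.Fin.Subset.Properties
open import Data.Vec using (lookup; []; _∷_; here; there)
open import Data.Vec.Properties using ([]=⇒lookup; lookup⇒[]=; lookup-map)
open import Data.List using (List; []; _∷_; _++_; length; filter; tabulate; concatMap; map; allFin)
open import Data.List.Properties using (length-++; filter-++; map-tabulate)
open import Data.List.Extrema.Nat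
  using (argmax; argmin; argmax-all; argmin-all; f[xs]≤f[argmax]; f[argmin]≤f[xs])
import Data.List.Relation.Unary.All as All
open import Data.List.Relation.Unary.All.Properties using (all-filter)
open import Data.List.Membership.Propositional using () renaming (_∈_ to _∈ₗ_)
open import Data.List.Membership.Propositional.Properties using (∈-filter⁺; ∈-allFin)
open import Data.Product using (_×_; ∃-syntax; _,_; proj₁; proj₂)
open import Data.Sum using (inj₁; inj₂)
open import Function using (id; _∘_; _⇔_; mk⇔; Equivalence)
open import Relation.Nullary using (yes; no; contradiction; ofʸ; ofⁿ)
open import Relation.Nullary.Decidable using (⌊_⌋)
open import Relation.Binary.Definitions using (tri<; tri≈; tri>)
open import Relation.Binary.PropositionalEquality
open import Algebra.Properties.Semiring.Sum +-*-semiring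
  using (sum; sum-cong-≗; sum-replicate-zero; ∑-distrib-+; ∑-comm; *-distribˡ-sum; *-distribʳ-sum)

-- Finite sums of natural numbers

𝟙 : Bool → ℕ
𝟙 true  = 1
𝟙 false = 0

δ : ∀ {n} → Fin n → Fin n → ℕ
δ i j = 𝟙 ⌊ i ≟ j ⌋

δ-refl : ∀ {n} (i : Fin n) → δ i i ≡ 1
δ-refl i with i ≟ i
... | yes _  = refl
... | no i≢i = contradiction refl i≢i

δ-≢ : ∀ {n} {i j : Fin n} → i ≢ j → δ i j ≡ 0
δ-≢ {i = i} {j} i≢j with i ≟ j
... | yes i≡j = contradiction i≡j i≢j
... | no _    = refl

δ-sym : ∀ {n} (i j : Fin n) → δ i j ≡ δ j i
δ-sym i j with i ≟ j | j ≟ i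
... | yes _   | yes _   = refl
... | no _    | no _    = refl
... | yes i≡j | no j≢i  = contradiction (sym i≡j) j≢i
... | no i≢j  | yes j≡i = contradiction (sym j≡i) i≢j

δ-pos⇒≡ : ∀ {n} {i j : Fin n} → 0 < δ i j → i ≡ j
δ-pos⇒≡ {i = i} {j} 0<δ with i ≟ j
... | yes i≡j = i≡j

δ-suc : ∀ {n} (i j : Fin n) → δ (suc i) (suc j) ≡ δ i j
δ-suc i j with i ≟ j
... | yes _ = refl
... | no _  = refl

sum-mono-≤ : ∀ {n} {f g : Fin n → ℕ} → (∀ i → f i ≤ g i) → sum f ≤ sum g
sum-mono-≤ {zero}  f≤g = z≤n
sum-mono-≤ {suc n} f≤g = +-mono-≤ (f≤g zero) (sum-mono-≤ (f≤g ∘ suc))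

sum-<⇒∃< : ∀ {n} (f g : Fin n → ℕ) → sum f < sum g → ∃[ i ] f i < g i
sum-<⇒∃< {suc n} f g ∑f<∑g with f zero <? g zero
... | yes f₀<g₀ = zero , f₀<g₀
... | no  f₀≮g₀ =
  let i , fᵢ<gᵢ = sum-<⇒∃< (f ∘ suc) (g ∘ suc)
                    (+-cancelˡ-< (f zero) _ _ (<-≤-trans ∑f<∑g (+-monoˡ-≤ _ (≮⇒≥ f₀≮g₀))))
  in suc i , fᵢ<gᵢ

sum-δ : ∀ {n} (a : Fin n) (f : Fin n → ℕ) → sum (λ i → δ i a * f i) ≡ f a
sum-δ {suc n} zero    f = trans (cong₂ _+_ (*-identityˡ (f zero)) (sum-replicate-zero n)) (+-identityʳ (f zero))
sum-δ {suc n} (suc a) f = begin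
  sum (λ i → δ (suc i) (suc a) * f (suc i))  ≡⟨ sum-cong-≗ (λ i → cong (_* f (suc i)) (δ-suc i a)) ⟩
  sum (λ i → δ i a * f (suc i))              ≡⟨ sum-δ a (f ∘ suc) ⟩
  f (suc a)                                  ∎
  where open ≡-Reasoning

sum-product : ∀ {m n} (f : Fin m → ℕ) (g : Fin n → ℕ) →
  sum (λ i → sum (λ j → f i * g j)) ≡ sum f * sum g
sum-product f g = begin
  sum (λ i → sum (λ j → f i * g j))  ≡⟨ sum-cong-≗ (λ i → sym (*-distribˡ-sum (f i) g)) ⟩
  sum (λ i → f i * sum g)            ≡⟨ sym (*-distribʳ-sum (sum g) f) ⟩
  sum f * sum g                      ∎
  where open ≡-Reasoning

sum₂-distrib-+ : ∀ {m n} (f g : Fin m → Fin n → ℕ) →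
  sum (λ u → sum (λ v → f u v + g u v)) ≡ sum (λ u → sum (f u)) + sum (λ u → sum (g u))
sum₂-distrib-+ f g =
  trans (sum-cong-≗ (λ u → ∑-distrib-+ (f u) (g u))) (∑-distrib-+ (λ u → sum (f u)) (λ u → sum (g u)))

δ≡sum-δ*δ : ∀ {k} (a b : Fin k) → δ a b ≡ sum (λ j → δ a j * δ b j)
δ≡sum-δ*δ a b = begin
  δ a b                      ≡⟨ δ-sym a b ⟩
  δ b a                      ≡⟨ sum-δ a (δ b) ⟨
  sum (λ j → δ j a * δ b j)  ≡⟨ sum-cong-≗ (λ j → cong (_* δ b j) (δ-sym j a)) ⟩
  sum (λ j → δ a j * δ b j)  ∎
  where open ≡-Reasoning

private
  square-+ : ∀ x d → (x + d) * (x + d) ≡ x * x + d * (2 * x + d)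
  square-+ = solve-∀

sumSq-bump : ∀ {k} (f : Fin k → ℕ) (a : Fin k) →
  sum (λ j → (f j + δ a j) * (f j + δ a j)) ≡ sum (λ j → f j * f j) + suc (2 * f a)
sumSq-bump f a = begin
  sum (λ j → (f j + δ a j) * (f j + δ a j))          ≡⟨ sum-cong-≗ (λ j → square-+ (f j) (δ a j)) ⟩
  sum (λ j → f j * f j + δ a j * (2 * f j + δ a j))  ≡⟨ ∑-distrib-+ (λ j → f j * f j) _ ⟩
  Σf² + sum (λ j → δ a j * (2 * f j + δ a j))
    ≡⟨ cong (Σf² +_) (sum-cong-≗ (λ j → cong (_* (2 * f j + δ a j)) (δ-sym a j))) ⟩
  Σf² + sum (λ j → δ j a * (2 * f j + δ a j))        ≡⟨ cong (Σf² +_) (sum-δ a _) ⟩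
  Σf² + (2 * f a + δ a a)                            ≡⟨ cong (λ e → Σf² + (2 * f a + e)) (δ-refl a) ⟩
  Σf² + (2 * f a + 1)                                ≡⟨ cong (Σf² +_) (+-comm (2 * f a) 1) ⟩
  Σf² + suc (2 * f a)                                ∎
  where
  open ≡-Reasoning
  Σf² : ℕ
  Σf² = sum (λ j → f j * f j)

sum-<ᵇ-symmetric : ∀ {n} (F : Fin n → Fin n → Bool) → (∀ u v → F u v ≡ F v u) → (∀ u → F u u ≡ false) →
  2 * sum (λ u → sum (λ v → 𝟙 ((toℕ u <ᵇ toℕ v) ∧ F u v))) ≡ sum (λ u → sum (λ v → 𝟙 (F u v)))
sum-<ᵇ-symmetric {n} F F-sym F-irrefl = begin
  2 * X                                       ≡⟨ cong (X +_) (+-identityʳ X) ⟩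
  X + X                                       ≡⟨ cong (X +_) (∑-comm L) ⟩
  X + sum (λ u → sum (λ v → L v u))           ≡⟨ ∑-distrib-+ (λ u → sum (L u)) _ ⟨
  sum (λ u → sum (L u) + sum (λ v → L v u))   ≡⟨ sum-cong-≗ (λ u → ∑-distrib-+ (L u) _) ⟨
  sum (λ u → sum (λ v → L u v + L v u))       ≡⟨ sum-cong-≗ (λ u → sum-cong-≗ (λ v → one-orientation u v)) ⟩
  sum (λ u → sum (λ v → 𝟙 (F u v)))           ∎
  where
  open ≡-Reasoning
  L : Fin n → Fin n → ℕ
  L u v = 𝟙 ((toℕ u <ᵇ toℕ v) ∧ F u v)
  X : ℕ
  X = sum (λ u → sum (L u))
  one-orientation : ∀ u v → L u v + L v u ≡ 𝟙 (F u v)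
  one-orientation u v with toℕ u <ᵇ toℕ v | <ᵇ-reflects-< (toℕ u) (toℕ v)
                         | toℕ v <ᵇ toℕ u | <ᵇ-reflects-< (toℕ v) (toℕ u)
  ... | true  | ofʸ u<v  | true  | ofʸ v<u  = contradiction v<u (<-asym u<v)
  ... | true  | _        | false | _        = +-identityʳ _
  ... | false | _        | true  | _        = cong 𝟙 (F-sym v u)
  ... | false | ofⁿ u≮v  | false | ofⁿ v≮u with toℕ-injective (≤-antisym (≮⇒≥ v≮u) (≮⇒≥ u≮v))
  ...   | refl = cong 𝟙 (sym (F-irrefl u))

length-filter-tabulate : ∀ {A : Set} {n} (p : A → Bool) (f : Fin n → A) →
  length (filter (T? ∘ p) (tabulate f)) ≡ sum (𝟙 ∘ p ∘ f)
length-filter-tabulate {n = zero}  p f = refl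
length-filter-tabulate {n = suc n} p f with p (f zero)
... | true  = cong suc (length-filter-tabulate p (f ∘ suc))
... | false = length-filter-tabulate p (f ∘ suc)

length-filter-concatMap : ∀ {A B : Set} {n} (p : B → Bool) (h : A → List B) (f : Fin n → A) →
  length (filter (T? ∘ p) (concatMap h (tabulate f))) ≡ sum (λ i → length (filter (T? ∘ p) (h (f i))))
length-filter-concatMap {n = zero}  p h f = refl
length-filter-concatMap {B = B} {n = suc n} p h f = begin
  length (filter (T? ∘ p) (h (f zero) ++ rest))                 ≡⟨ cong length (filter-++ (T? ∘ p) (h (f zero)) rest) ⟩
  length (filter (T? ∘ p) (h (f zero)) ++ filter (T? ∘ p) rest) ≡⟨ length-++ (filter (T? ∘ p) (h (f zero))) ⟩
  _ + length (filter (T? ∘ p) rest)                             ≡⟨ cong (_ +_) (length-filter-concatMap p h (f ∘ suc)) ⟩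
  _                                                             ∎
  where
  open ≡-Reasoning
  rest : List B
  rest = concatMap h (tabulate (f ∘ suc))

count≡sum : ∀ {n} (p : Fin n → Bool) → count p ≡ sum (𝟙 ∘ p)
count≡sum p = length-filter-tabulate p id

edgesTouching≡sum : ∀ {n} (G : Graph n) (S : Subset n) → edgesTouching G S ≡
  sum (λ u → sum (λ v → 𝟙 ((toℕ u <ᵇ toℕ v) ∧ adj G u v ∧ (lookup S u ∨ lookup S v))))
edgesTouching≡sum {n} G S = begin
  edgesTouching G S                                          ≡⟨ length-filter-concatMap touches (λ u → map (u ,_) (allFin n)) id ⟩
  sum (λ u → length (filter (T? ∘ touches) (map (u ,_) (allFin n))))
    ≡⟨ sum-cong-≗ (λ u → cong (length ∘ filter (T? ∘ touches)) (map-tabulate id (u ,_))) ⟩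
  sum (λ u → length (filter (T? ∘ touches) (tabulate (u ,_))))
    ≡⟨ sum-cong-≗ (λ u → length-filter-tabulate touches (u ,_)) ⟩
  _                                                          ∎
  where
  open ≡-Reasoning
  touches : Fin n × Fin n → Bool
  touches (u , v) = (toℕ u <ᵇ toℕ v) ∧ adj G u v ∧ (lookup S u ∨ lookup S v)

-- Subsets of Fin n

x∈p─q⇒x∉q : ∀ {n} {p q : Subset n} {x} → x ∈ p ─ q → x ∉ q
x∈p─q⇒x∉q {p = inside ∷ p} {outside ∷ q} here           ()
x∈p─q⇒x∉q {p = _ ∷ p}      {_ ∷ q}       (there x∈p─q) (there x∈q) = x∈p─q⇒x∉q x∈p─q x∈q

x∈p-y⇒x≢y : ∀ {n} {p : Subset n} {x y} → x ∈ p - y → x ≢ y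
x∈p-y⇒x≢y x∈p-y refl = x∈p─q⇒x∉q x∈p-y (x∈⁅x⁆ _)

x∉p-x : ∀ {n} (p : Subset n) x → x ∉ p - x
x∉p-x p x x∈p-x = x∈p-y⇒x≢y x∈p-x refl

lookup-∉ : ∀ {n} {p : Subset n} {x} → x ∉ p → lookup p x ≡ false
lookup-∉ {p = p} {x} x∉p with lookup p x in eq
... | true  = contradiction (lookup⇒[]= x p eq) x∉p
... | false = refl

lookup≡false⇒∉ : ∀ {n} {p : Subset n} {x} → lookup p x ≡ false → x ∉ p
lookup≡false⇒∉ eq x∈p = contradiction (trans (sym ([]=⇒lookup x∈p)) eq) λ ()

lookup-cong : ∀ {n} {p q : Subset n} {x} → (x ∈ p → x ∈ q) → (x ∈ q → x ∈ p) → lookup p x ≡ lookup q x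
lookup-cong {p = p} {q} {x} p→q q→p with lookup p x in eq
... | true  = sym ([]=⇒lookup (p→q (lookup⇒[]= x p eq)))
... | false = sym (lookup-∉ (lookup≡false⇒∉ eq ∘ q→p))

sumOver : ∀ {n} → Subset n → (Fin n → ℕ) → ℕ
sumOver p g = sum (λ x → 𝟙 (lookup p x) * g x)

∣p∣≡sum : ∀ {n} (p : Subset n) → ∣ p ∣ ≡ sum (𝟙 ∘ lookup p)
∣p∣≡sum []            = refl
∣p∣≡sum (inside  ∷ p) = cong suc (∣p∣≡sum p)
∣p∣≡sum (outside ∷ p) = ∣p∣≡sum p

∣p∣≡sumOver : ∀ {n} (p : Subset n) → ∣ p ∣ ≡ sumOver p (λ _ → 1)
∣p∣≡sumOver p = trans (∣p∣≡sum p) (sum-cong-≗ (λ x → sym (*-identityʳ (𝟙 (lookup p x)))))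

𝟙-lookup-remove : ∀ {n} {p : Subset n} {w} → w ∈ p → ∀ x → 𝟙 (lookup p x) ≡ δ x w + 𝟙 (lookup (p - w) x)
𝟙-lookup-remove {p = p} {w} w∈p x with x ≟ w
... | yes refl rewrite []=⇒lookup w∈p | lookup-∉ (x∉p-x p w) = refl
... | no x≢w   = cong 𝟙 (lookup-cong (λ x∈p → x∈p∧x≢y⇒x∈p-y x∈p x≢w) (p─q⊆p p ⁅ w ⁆))

sumOver-remove : ∀ {n} {p : Subset n} {w} (g : Fin n → ℕ) → w ∈ p → sumOver p g ≡ g w + sumOver (p - w) g
sumOver-remove {p = p} {w} g w∈p = begin
  sum (λ x → 𝟙 (lookup p x) * g x)                          ≡⟨ sum-cong-≗ (λ x → cong (_* g x) (𝟙-lookup-remove w∈p x)) ⟩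
  sum (λ x → (δ x w + 𝟙 (lookup (p - w) x)) * g x)          ≡⟨ sum-cong-≗ (λ x → *-distribʳ-+ (g x) (δ x w) _) ⟩
  sum (λ x → δ x w * g x + 𝟙 (lookup (p - w) x) * g x)      ≡⟨ ∑-distrib-+ (λ x → δ x w * g x) _ ⟩
  sum (λ x → δ x w * g x) + sumOver (p - w) g              ≡⟨ cong (_+ sumOver (p - w) g) (sum-δ w g) ⟩
  g w + sumOver (p - w) g                                  ∎
  where open ≡-Reasoning

∣p∣≡1+∣p-x∣ : ∀ {n} {p : Subset n} {x} → x ∈ p → ∣ p ∣ ≡ suc ∣ p - x ∣
∣p∣≡1+∣p-x∣ {p = p} {x} x∈p = begin
  ∣ p ∣                          ≡⟨ ∣p∣≡sumOver p ⟩
  sumOver p (λ _ → 1)            ≡⟨ sumOver-remove (λ _ → 1) x∈p ⟩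
  suc (sumOver (p - x) (λ _ → 1)) ≡⟨ cong suc (∣p∣≡sumOver (p - x)) ⟨
  suc ∣ p - x ∣                   ∎
  where open ≡-Reasoning

sumOver-mono-⊆ : ∀ {n} {p q : Subset n} (g : Fin n → ℕ) → p ⊆ q → sumOver p g ≤ sumOver q g
sumOver-mono-⊆ {p = p} {q} g p⊆q = sum-mono-≤ (λ x → *-monoˡ-≤ (g x) (𝟙-mono x))
  where
  𝟙-mono : ∀ x → 𝟙 (lookup p x) ≤ 𝟙 (lookup q x)
  𝟙-mono x with lookup p x in eq
  ... | true  rewrite []=⇒lookup (p⊆q (lookup⇒[]= x p eq)) = ≤-refl
  ... | false = z≤n

sumOver-<⇒∃ : ∀ {n} {p q : Subset n} (g : Fin n → ℕ) → sumOver p g < sumOver q g →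
  ∃[ x ] x ∈ q × x ∉ p × 0 < g x
sumOver-<⇒∃ {p = p} {q} g ∑p<∑q with sum-<⇒∃< _ _ ∑p<∑q
... | x , lt with lookup p x in eqp | lookup q x in eqq
...   | false | true  = x , lookup⇒[]= x q eqq , lookup≡false⇒∉ eqp , subst (0 <_) (+-identityʳ (g x)) lt
...   | true  | true  = contradiction lt (<-irrefl refl)
...   | _     | false = contradiction lt λ ()

0<∣p∣⇒Nonempty : ∀ {n} {p : Subset n} → 0 < ∣ p ∣ → Nonempty p
0<∣p∣⇒Nonempty {n} {p} 0<∣p∣ with nonempty? p
... | yes ne = ne
... | no ¬ne = contradiction (trans (cong ∣_∣ (Empty-unique ¬ne)) (∣⊥∣≡0 n)) (>⇒≢ 0<∣p∣)

∁-involutive : ∀ {n} (p : Subset n) → ∁ (∁ p) ≡ p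
∁-involutive p = ⊆-antisym (x∉∁p⇒x∈p ∘ x∈∁p⇒x∉p) (x∉p⇒x∈∁p ∘ x∈p⇒x∉∁p)

∣p∣≡∣q∣⇒∣∁p∣≡∣∁q∣ : ∀ {n} {p q : Subset n} → ∣ p ∣ ≡ ∣ q ∣ → ∣ ∁ p ∣ ≡ ∣ ∁ q ∣
∣p∣≡∣q∣⇒∣∁p∣≡∣∁q∣ {n} {p} {q} ∣p∣≡∣q∣ =
  trans (∣∁p∣≡n∸∣p∣ p) (trans (cong (n ∸_) ∣p∣≡∣q∣) (sym (∣∁p∣≡n∸∣p∣ q)))

⊤─p≡∁p : ∀ {n} (p : Subset n) → ⊤ ─ p ≡ ∁ p
⊤─p≡∁p []            = refl
⊤─p≡∁p (inside  ∷ p) = cong (outside ∷_) (⊤─p≡∁p p)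
⊤─p≡∁p (outside ∷ p) = cong (inside ∷_) (⊤─p≡∁p p)

∣p∣≡0⇒p≡⊥ : ∀ {n} {p : Subset n} → ∣ p ∣ ≡ 0 → p ≡ ⊥
∣p∣≡0⇒p≡⊥ {p = p} ∣p∣≡0 with nonempty? p
... | yes (x , x∈p) = contradiction (subst (∣ p - x ∣ <_) ∣p∣≡0 (x∈p⇒∣p-x∣<∣p∣ x∈p)) λ ()
... | no  ¬nonempty = Empty-unique ¬nonempty

⁅x⁆-x≡⊥ : ∀ {n} (x : Fin n) → ⁅ x ⁆ - x ≡ ⊥
⁅x⁆-x≡⊥ x = Empty-unique λ (y , y∈⁅x⁆-x) →
  x∈p-y⇒x≢y y∈⁅x⁆-x (x∈⁅y⁆⇒x≡y x (p─q⊆p ⁅ x ⁆ ⁅ x ⁆ y∈⁅x⁆-x))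

[p∪q]-x≡p∪[q-x] : ∀ {n} (p q : Subset n) {x} → x ∉ p → (p ∪ q) - x ≡ p ∪ (q - x)
[p∪q]-x≡p∪[q-x] p q {x} x∉p = ⊆-antisym ⊆₁ ⊆₂
  where
  ⊆₁ : (p ∪ q) - x ⊆ p ∪ (q - x)
  ⊆₁ {y} y∈ with x∈p∪q⁻ p q (p─q⊆p _ _ y∈)
  ... | inj₁ y∈p = x∈p∪q⁺ (inj₁ y∈p)
  ... | inj₂ y∈q = x∈p∪q⁺ (inj₂ (x∈p∧x≢y⇒x∈p-y y∈q (x∈p-y⇒x≢y y∈)))
  ⊆₂ : p ∪ (q - x) ⊆ (p ∪ q) - x
  ⊆₂ {y} y∈ with x∈p∪q⁻ p (q - x) y∈
  ... | inj₁ y∈p   = x∈p∧x≢y⇒x∈p-y (x∈p∪q⁺ (inj₁ y∈p)) (λ { refl → x∉p y∈p })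
  ... | inj₂ y∈q-x = x∈p∧x≢y⇒x∈p-y (x∈p∪q⁺ (inj₂ (p─q⊆p _ _ y∈q-x))) (x∈p-y⇒x≢y y∈q-x)

⁅x⁆∪[p-x]≡p : ∀ {n} {p : Subset n} {x} → x ∈ p → ⁅ x ⁆ ∪ (p - x) ≡ p
⁅x⁆∪[p-x]≡p {p = p} {x} x∈p = ⊆-antisym ⊆₁ ⊆₂
  where
  ⊆₁ : ⁅ x ⁆ ∪ (p - x) ⊆ p
  ⊆₁ y∈ with x∈p∪q⁻ ⁅ x ⁆ (p - x) y∈
  ... | inj₁ y∈⁅x⁆  = subst (_∈ p) (sym (x∈⁅y⁆⇒x≡y x y∈⁅x⁆)) x∈p
  ... | inj₂ y∈p-x = p─q⊆p _ _ y∈p-x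
  ⊆₂ : p ⊆ ⁅ x ⁆ ∪ (p - x)
  ⊆₂ {y} y∈p with y ≟ x
  ... | yes refl = x∈p∪q⁺ (inj₁ (x∈⁅x⁆ x))
  ... | no  y≢x  = x∈p∪q⁺ (inj₂ (x∈p∧x≢y⇒x∈p-y y∈p y≢x))

sumOver-swap : ∀ {n} {p : Subset n} {u v} (g : Fin n → ℕ) → u ∉ p → v ∈ p →
  sumOver ((p ∪ ⁅ u ⁆) - v) g + g v ≡ sumOver p g + g u
sumOver-swap {p = p} {u} {v} g u∉p v∈p = begin
  sumOver ((p ∪ ⁅ u ⁆) - v) g + g v  ≡⟨ +-comm _ (g v) ⟩
  g v + sumOver ((p ∪ ⁅ u ⁆) - v) g  ≡⟨ sumOver-remove g (x∈p∪q⁺ (inj₁ v∈p)) ⟨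
  sumOver (p ∪ ⁅ u ⁆) g              ≡⟨ sumOver-remove g (x∈p∪q⁺ {p = p} (inj₂ (x∈⁅x⁆ u))) ⟩
  g u + sumOver ((p ∪ ⁅ u ⁆) - u) g  ≡⟨ cong (λ q → g u + sumOver q g) [p∪⁅u⁆]-u≡p ⟩
  g u + sumOver p g                  ≡⟨ +-comm (g u) _ ⟩
  sumOver p g + g u                  ∎
  where
  open ≡-Reasoning
  [p∪⁅u⁆]-u≡p : (p ∪ ⁅ u ⁆) - u ≡ p
  [p∪⁅u⁆]-u≡p = begin
    (p ∪ ⁅ u ⁆) - u  ≡⟨ [p∪q]-x≡p∪[q-x] p ⁅ u ⁆ u∉p ⟩
    p ∪ (⁅ u ⁆ - u)  ≡⟨ cong (p ∪_) (⁅x⁆-x≡⊥ u) ⟩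
    p ∪ ⊥            ≡⟨ ∪-identityʳ p ⟩
    p                ∎

∣[p∪⁅u⁆]-v∣≡∣p∣ : ∀ {n} {p : Subset n} {u v} → u ∉ p → v ∈ p → ∣ (p ∪ ⁅ u ⁆) - v ∣ ≡ ∣ p ∣
∣[p∪⁅u⁆]-v∣≡∣p∣ {p = p} {u} {v} u∉p v∈p = +-cancelʳ-≡ 1 _ _ (begin
  ∣ (p ∪ ⁅ u ⁆) - v ∣ + 1               ≡⟨ cong (_+ 1) (∣p∣≡sumOver ((p ∪ ⁅ u ⁆) - v)) ⟩
  sumOver ((p ∪ ⁅ u ⁆) - v) (λ _ → 1) + 1 ≡⟨ sumOver-swap (λ _ → 1) u∉p v∈p ⟩
  sumOver p (λ _ → 1) + 1               ≡⟨ cong (_+ 1) (∣p∣≡sumOver p) ⟨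
  ∣ p ∣ + 1                             ∎)
  where open ≡-Reasoning

module _ {n} (f : Fin n → ℕ) {p : Subset n} where

  private
    members : List (Fin n)
    members = filter (_∈? p) (allFin n)

    ∈-members : ∀ {x} → x ∈ p → x ∈ₗ members
    ∈-members {x} x∈p = ∈-filter⁺ (_∈? p) (∈-allFin x) x∈p

  ∃-argmax : Nonempty p → ∃[ w ] w ∈ p × (∀ {v} → v ∈ p → f v ≤ f w)
  ∃-argmax (w₀ , w₀∈p) =
    argmax f w₀ members , argmax-all f w₀∈p (all-filter (_∈? p) (allFin n)) ,
    λ v∈p → All.lookup (f[xs]≤f[argmax] w₀ members) (∈-members v∈p)

  ∃-argmin : Nonempty p → ∃[ w ] w ∈ p × (∀ {v} → v ∈ p → f w ≤ f v)
  ∃-argmin (w₀ , w₀∈p) =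
    argmin f w₀ members , argmin-all f w₀∈p (all-filter (_∈? p) (allFin n)) ,
    λ v∈p → All.lookup (f[argmin]≤f[xs] w₀ members) (∈-members v∈p)

-- Discrete convexity

private
  square-split : ∀ x d b → (x + d) * (x + d) + b * x ≡ (x * x + b * x) + (2 * x + d) * d
  square-split = solve-∀

  linear-split : ∀ x d b → x * x + b * (x + d) ≡ (x * x + b * x) + b * d
  linear-split = solve-∀

  double-+ : ∀ y d → 2 * y + d + d ≡ 2 * (y + d)
  double-+ = solve-∀

-- t ↦ t² − (2a + 1)·t is smallest at t = a and t = a + 1, and x lies between y and that minimum.
threshold-square : ∀ a x y → (x < y → a ≤ x) → (y < x → x ≤ suc a) →
  x * x + suc (2 * a) * y ≤ y * y + suc (2 * a) * x
threshold-square a x y x<y⇒a≤x y<x⇒x≤1+a with <-cmp x y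
... | tri≈ _ refl _ = ≤-refl
... | tri< x<y _ _ = subst (λ z → x * x + b * z ≤ z * z + b * x) (m+[n∸m]≡n (<⇒≤ x<y)) (begin
  x * x + b * (x + d)                ≡⟨ linear-split x d b ⟩
  (x * x + b * x) + b * d            ≤⟨ +-monoʳ-≤ (x * x + b * x) (*-monoˡ-≤ d b≤2x+d) ⟩
  (x * x + b * x) + (2 * x + d) * d  ≡⟨ square-split x d b ⟨
  (x + d) * (x + d) + b * x          ∎)
  where
  open ≤-Reasoning
  b d : ℕ
  b = suc (2 * a)
  d = y ∸ x
  b≤2x+d : b ≤ 2 * x + d
  b≤2x+d = ≤-trans (+-mono-≤ (m<n⇒0<n∸m x<y) (*-monoʳ-≤ 2 (x<y⇒a≤x x<y))) (≤-reflexive (+-comm d (2 * x)))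
... | tri> _ _ y<x = subst (λ z → z * z + b * y ≤ y * y + b * z) (m+[n∸m]≡n (<⇒≤ y<x)) (begin
  (y + d) * (y + d) + b * y          ≡⟨ square-split y d b ⟩
  (y * y + b * y) + (2 * y + d) * d  ≤⟨ +-monoʳ-≤ (y * y + b * y) (*-monoˡ-≤ d 2y+d≤b) ⟩
  (y * y + b * y) + b * d            ≡⟨ linear-split y d b ⟨
  y * y + b * (y + d)                ∎)
  where
  open ≤-Reasoning
  b d : ℕ
  b = suc (2 * a)
  d = x ∸ y
  2y+d≤b : 2 * y + d ≤ b
  2y+d≤b = s≤s⁻¹ (begin
    suc (2 * y + d)    ≡⟨ +-comm 1 (2 * y + d) ⟩
    2 * y + d + 1      ≤⟨ +-monoʳ-≤ (2 * y + d) (m<n⇒0<n∸m y<x) ⟩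
    2 * y + d + d      ≡⟨ double-+ y d ⟩
    2 * (y + d)        ≤⟨ *-monoʳ-≤ 2 (subst (_≤ suc a) (sym (m+[n∸m]≡n (<⇒≤ y<x))) (y<x⇒x≤1+a y<x)) ⟩
    2 * suc a          ≡⟨ *-suc 2 a ⟩
    suc b              ∎)

sumSq-threshold-≤ : ∀ {k} (m m' : Fin k → ℕ) (a : ℕ) → sum m ≡ sum m' →
  (∀ j → m j < m' j → a ≤ m j) → (∀ j → m' j < m j → m j ≤ suc a) →
  sum (λ j → m j * m j) ≤ sum (λ j → m' j * m' j)
sumSq-threshold-≤ m m' a ∑m≡∑m' below above = +-cancelʳ-≤ (b * sum m') _ _ (begin
  sum (λ j → m j * m j) + b * sum m'           ≡⟨ cong (_ +_) (*-distribˡ-sum b m') ⟩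
  sum (λ j → m j * m j) + sum (λ j → b * m' j) ≡⟨ ∑-distrib-+ (λ j → m j * m j) _ ⟨
  sum (λ j → m j * m j + b * m' j)             ≤⟨ sum-mono-≤ (λ j → threshold-square a (m j) (m' j) (below j) (above j)) ⟩
  sum (λ j → m' j * m' j + b * m j)            ≡⟨ ∑-distrib-+ (λ j → m' j * m' j) _ ⟩
  sum (λ j → m' j * m' j) + sum (λ j → b * m j) ≡⟨ cong (_ +_) (*-distribˡ-sum b m) ⟨
  sum (λ j → m' j * m' j) + b * sum m          ≡⟨ cong (λ s → sum (λ j → m' j * m' j) + b * s) ∑m≡∑m' ⟩
  sum (λ j → m' j * m' j) + b * sum m'         ∎)
  where
  open ≤-Reasoning
  b : ℕ
  b = suc (2 * a)

-- Complete multipartite graphs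

private
  +-≡-antitone : ∀ {a b a' b'} → a + b ≡ a' + b' → a ≤ a' → b' ≤ b
  +-≡-antitone {a} {b} {a'} {b'} eq a≤a' = +-cancelˡ-≤ a b' b (begin
    a + b'   ≤⟨ +-monoˡ-≤ b' a≤a' ⟩
    a' + b'  ≡⟨ eq ⟨
    a + b    ∎)
    where open ≤-Reasoning

  𝟙-∧-not : ∀ r e → 𝟙 (r ∧ not e) + 𝟙 r * 𝟙 e ≡ 𝟙 r * 1
  𝟙-∧-not true  true  = refl
  𝟙-∧-not true  false = refl
  𝟙-∧-not false _     = refl

  𝟙-∨-split : ∀ a p q → 𝟙 (a ∧ (p ∨ q)) + 𝟙 (a ∧ (not p ∧ not q)) ≡ 𝟙 a
  𝟙-∨-split true  true  _     = refl
  𝟙-∨-split true  false true  = refl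
  𝟙-∨-split true  false false = refl
  𝟙-∨-split false _     _     = refl

  𝟙-same-part : ∀ e p q → 𝟙 (not e ∧ (p ∧ q)) + 𝟙 p * 𝟙 q * 𝟙 e ≡ 𝟙 p * 𝟙 q
  𝟙-same-part true  true  true  = refl
  𝟙-same-part false true  true  = refl
  𝟙-same-part true  true  false = refl
  𝟙-same-part false true  false = refl
  𝟙-same-part true  false _     = refl
  𝟙-same-part false false _     = refl

module CompleteMultipartite {n k} (G : Graph n) (c : Fin n → Fin k)
                            (adj≡ : ∀ u v → adj G u v ≡ not ⌊ c u ≟ c v ⌋) where

  partSize : Subset n → Fin k → ℕ
  partSize T j = sumOver T (λ x → δ (c x) j)

  sumSq : Subset n → ℕ
  sumSq T = sum (λ j → partSize T j * partSize T j)

  degIn+partSize : ∀ R u → degIn G R u + partSize R (c u) ≡ ∣ R ∣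
  degIn+partSize R u = begin
    degIn G R u + partSize R (c u)
      ≡⟨ cong (_+ partSize R (c u)) (count≡sum (λ v → lookup R v ∧ adj G u v)) ⟩
    sum (λ v → 𝟙 (lookup R v ∧ adj G u v)) + partSize R (c u)
      ≡⟨ ∑-distrib-+ (λ v → 𝟙 (lookup R v ∧ adj G u v)) _ ⟨
    sum (λ v → 𝟙 (lookup R v ∧ adj G u v) + 𝟙 (lookup R v) * δ (c v) (c u))
      ≡⟨ sum-cong-≗ (λ v → pointwise v) ⟩
    sumOver R (λ _ → 1)
      ≡⟨ ∣p∣≡sumOver R ⟨
    ∣ R ∣ ∎
    where
    open ≡-Reasoning
    pointwise : ∀ v → 𝟙 (lookup R v ∧ adj G u v) + 𝟙 (lookup R v) * δ (c v) (c u) ≡ 𝟙 (lookup R v) * 1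
    pointwise v rewrite adj≡ u v | δ-sym (c v) (c u) = 𝟙-∧-not (lookup R v) ⌊ c u ≟ c v ⌋

  degIn-≤⇔partSize-≥ : ∀ R u v → degIn G R u ≤ degIn G R v ⇔ partSize R (c v) ≤ partSize R (c u)
  degIn-≤⇔partSize-≥ R u v = mk⇔ (+-≡-antitone same-total) (+-≡-antitone same-total′)
    where
    same-total : degIn G R u + partSize R (c u) ≡ degIn G R v + partSize R (c v)
    same-total = trans (degIn+partSize R u) (sym (degIn+partSize R v))
    same-total′ : partSize R (c v) + degIn G R v ≡ partSize R (c u) + degIn G R u
    same-total′ = trans (+-comm _ (degIn G R v)) (trans (sym same-total) (+-comm (degIn G R u) _))

  sumSq≡sum-same-part : ∀ T →
    sum (λ u → sum (λ v → 𝟙 (lookup T u) * 𝟙 (lookup T v) * δ (c u) (c v))) ≡ sumSq T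
  sumSq≡sum-same-part T = begin
    sum (λ u → sum (λ v → t u * t v * δ (c u) (c v)))
      ≡⟨ sum-cong-≗ (λ u → sum-cong-≗ (λ v → spread u v)) ⟩
    sum (λ u → sum (λ v → sum (λ j → m u j * m v j)))
      ≡⟨ sum-cong-≗ (λ u → ∑-comm (λ v j → m u j * m v j)) ⟩
    sum (λ u → sum (λ j → sum (λ v → m u j * m v j)))
      ≡⟨ ∑-comm (λ u j → sum (λ v → m u j * m v j)) ⟩
    sum (λ j → sum (λ u → sum (λ v → m u j * m v j)))
      ≡⟨ sum-cong-≗ (λ j → sum-product (λ u → m u j) (λ v → m v j)) ⟩
    sumSq T ∎
    where
    open ≡-Reasoning
    t : Fin n → ℕ
    t = 𝟙 ∘ lookup T
    m : Fin n → Fin k → ℕ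
    m x j = t x * δ (c x) j
    regroup : ∀ a b x y → a * b * (x * y) ≡ (a * x) * (b * y)
    regroup = solve-∀
    spread : ∀ u v → t u * t v * δ (c u) (c v) ≡ sum (λ j → m u j * m v j)
    spread u v = begin
      t u * t v * δ (c u) (c v)                         ≡⟨ cong (t u * t v *_) (δ≡sum-δ*δ (c u) (c v)) ⟩
      t u * t v * sum (λ j → δ (c u) j * δ (c v) j)     ≡⟨ *-distribˡ-sum (t u * t v) (λ j → δ (c u) j * δ (c v) j) ⟩
      sum (λ j → t u * t v * (δ (c u) j * δ (c v) j))   ≡⟨ sum-cong-≗ (λ j → regroup (t u) (t v) (δ (c u) j) (δ (c v) j)) ⟩
      sum (λ j → m u j * m v j)                         ∎

  -- An adjacent ordered pair either touches S or lies in ∁ S × ∁ S, and the pairs of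
  -- ∁ S × ∁ S that are not adjacent are exactly those inside one part.
  edgesTouching-identity : ∀ S →
    2 * edgesTouching G S + ∣ ∁ S ∣ * ∣ ∁ S ∣ ≡ sum (λ u → sum (λ v → 𝟙 (adj G u v))) + sumSq (∁ S)
  edgesTouching-identity S = begin
    2 * edgesTouching G S + ∣ ∁ S ∣ * ∣ ∁ S ∣  ≡⟨ cong₂ _+_ touching-pairs (sym inside-pairs) ⟩
    Touching + (Inside + SamePart)            ≡⟨ +-assoc Touching Inside SamePart ⟨
    Touching + Inside + SamePart              ≡⟨ cong (_+ SamePart) all-pairs ⟩
    Adjacent + SamePart                       ≡⟨ cong (Adjacent +_) (sumSq≡sum-same-part (∁ S)) ⟩
    Adjacent + sumSq (∁ S)                    ∎
    where
    open ≡-Reasoning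
    s t : Fin n → Bool
    s = lookup S
    t = lookup (∁ S)
    t≡not-s : ∀ x → t x ≡ not (s x)
    t≡not-s x = lookup-map x not S
    Adjacent Touching Inside SamePart : ℕ
    Adjacent = sum (λ u → sum (λ v → 𝟙 (adj G u v)))
    Touching = sum (λ u → sum (λ v → 𝟙 (adj G u v ∧ (s u ∨ s v))))
    Inside   = sum (λ u → sum (λ v → 𝟙 (adj G u v ∧ (t u ∧ t v))))
    SamePart = sum (λ u → sum (λ v → 𝟙 (t u) * 𝟙 (t v) * δ (c u) (c v)))

    touching-pairs : 2 * edgesTouching G S ≡ Touching
    touching-pairs = trans (cong (2 *_) (edgesTouching≡sum G S))
      (sum-<ᵇ-symmetric (λ u v → adj G u v ∧ (s u ∨ s v))
        (λ u v → cong₂ _∧_ (adj-sym G u v) (∨-comm (s u) (s v)))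
        (λ u → cong (_∧ (s u ∨ s u)) (adj-irrefl G u)))

    all-pairs : Touching + Inside ≡ Adjacent
    all-pairs = trans
      (sym (sum₂-distrib-+ (λ u v → 𝟙 (adj G u v ∧ (s u ∨ s v))) (λ u v → 𝟙 (adj G u v ∧ (t u ∧ t v)))))
                      (sum-cong-≗ (λ u → sum-cong-≗ (λ v → pointwise u v)))
      where
      pointwise : ∀ u v → 𝟙 (adj G u v ∧ (s u ∨ s v)) + 𝟙 (adj G u v ∧ (t u ∧ t v)) ≡ 𝟙 (adj G u v)
      pointwise u v rewrite t≡not-s u | t≡not-s v = 𝟙-∨-split (adj G u v) (s u) (s v)

    inside-pairs : Inside + SamePart ≡ ∣ ∁ S ∣ * ∣ ∁ S ∣
    inside-pairs = begin
      Inside + SamePart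
        ≡⟨ sum₂-distrib-+ (λ u v → 𝟙 (adj G u v ∧ (t u ∧ t v)))
                          (λ u v → 𝟙 (t u) * 𝟙 (t v) * δ (c u) (c v)) ⟨
      sum (λ u → sum (λ v → 𝟙 (adj G u v ∧ (t u ∧ t v)) + 𝟙 (t u) * 𝟙 (t v) * δ (c u) (c v)))
        ≡⟨ sum-cong-≗ (λ u → sum-cong-≗ (λ v → pointwise u v)) ⟩
      sum (λ u → sum (λ v → 𝟙 (t u) * 𝟙 (t v)))
        ≡⟨ sum-product (𝟙 ∘ t) (𝟙 ∘ t) ⟩
      sum (𝟙 ∘ t) * sum (𝟙 ∘ t)                  ≡⟨ cong₂ _*_ (∣p∣≡sum (∁ S)) (∣p∣≡sum (∁ S)) ⟨
      ∣ ∁ S ∣ * ∣ ∁ S ∣                           ∎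
      where
      pointwise : ∀ u v → 𝟙 (adj G u v ∧ (t u ∧ t v)) + 𝟙 (t u) * 𝟙 (t v) * δ (c u) (c v) ≡ 𝟙 (t u) * 𝟙 (t v)
      pointwise u v rewrite adj≡ u v = 𝟙-same-part ⌊ c u ≟ c v ⌋ (t u) (t v)

  edgesTouching-≤⇔sumSq-≤ : ∀ {S S'} → ∣ S ∣ ≡ ∣ S' ∣ →
    edgesTouching G S ≤ edgesTouching G S' ⇔ sumSq (∁ S) ≤ sumSq (∁ S')
  edgesTouching-≤⇔sumSq-≤ {S} {S'} ∣S∣≡∣S'∣ = mk⇔ to from
    where
    open ≤-Reasoning
    E E' N A : ℕ
    E  = edgesTouching G S
    E' = edgesTouching G S'
    N  = ∣ ∁ S ∣
    A  = sum (λ u → sum (λ v → 𝟙 (adj G u v)))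
    identity' : 2 * E' + N * N ≡ A + sumSq (∁ S')
    identity' = subst (λ m → 2 * E' + m * m ≡ A + sumSq (∁ S'))
                      (∣p∣≡∣q∣⇒∣∁p∣≡∣∁q∣ {p = S'} {S} (sym ∣S∣≡∣S'∣))
                      (edgesTouching-identity S')
    to : E ≤ E' → sumSq (∁ S) ≤ sumSq (∁ S')
    to E≤E' = +-cancelˡ-≤ A _ _ (begin
      A + sumSq (∁ S)   ≡⟨ edgesTouching-identity S ⟨
      2 * E + N * N     ≤⟨ +-monoˡ-≤ (N * N) (*-monoʳ-≤ 2 E≤E') ⟩
      2 * E' + N * N    ≡⟨ identity' ⟩
      A + sumSq (∁ S')  ∎)
    from : sumSq (∁ S) ≤ sumSq (∁ S') → E ≤ E'
    from Q≤Q' = *-cancelˡ-≤ 2 (+-cancelʳ-≤ (N * N) _ _ (begin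
      2 * E + N * N     ≡⟨ edgesTouching-identity S ⟩
      A + sumSq (∁ S)   ≤⟨ +-monoʳ-≤ A Q≤Q' ⟩
      A + sumSq (∁ S')  ≡⟨ identity' ⟨
      2 * E' + N * N    ∎))

  partSize-remove : ∀ {R w} → w ∈ R → ∀ j → partSize R j ≡ δ (c w) j + partSize (R - w) j
  partSize-remove w∈R j = sumOver-remove (λ x → δ (c x) j) w∈R

  partSize-removed-part : ∀ {R w} → w ∈ R → partSize R (c w) ≡ suc (partSize (R - w) (c w))
  partSize-removed-part {R} {w} w∈R =
    trans (partSize-remove w∈R (c w)) (cong (_+ partSize (R - w) (c w)) (δ-refl (c w)))

  partSize-other-part : ∀ {R w} → w ∈ R → ∀ {j} → c w ≢ j → partSize R j ≡ partSize (R - w) j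
  partSize-other-part {R} {w} w∈R {j} cw≢j =
    trans (partSize-remove w∈R j) (cong (_+ partSize (R - w) j) (δ-≢ cw≢j))

  partSize-mono-⊆ : ∀ {R R'} → R ⊆ R' → ∀ j → partSize R j ≤ partSize R' j
  partSize-mono-⊆ R⊆R' j = sumOver-mono-⊆ (λ x → δ (c x) j) R⊆R'

  sum-partSize : ∀ T → sum (partSize T) ≡ ∣ T ∣
  sum-partSize T = begin
    sum (λ j → sum (λ x → t x * δ (c x) j))  ≡⟨ ∑-comm (λ j x → t x * δ (c x) j) ⟩
    sum (λ x → sum (λ j → t x * δ (c x) j))  ≡⟨ sum-cong-≗ (λ x → sym (*-distribˡ-sum (t x) (δ (c x)))) ⟩
    sum (λ x → t x * sum (δ (c x)))          ≡⟨ sum-cong-≗ (λ x → cong (t x *_) (sum-δ-one (c x))) ⟩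
    sumOver T (λ _ → 1)                      ≡⟨ ∣p∣≡sumOver T ⟨
    ∣ T ∣                                    ∎
    where
    open ≡-Reasoning
    t : Fin n → ℕ
    t = 𝟙 ∘ lookup T
    sum-δ-one : ∀ a → sum (δ a) ≡ 1
    sum-δ-one a = trans (sum-cong-≗ (λ j → trans (δ-sym a j) (sym (*-identityʳ (δ j a))))) (sum-δ a (λ _ → 1))

  -- T is the set of vertices kept, i.e. not (yet) deleted.
  Balanced : Subset n → Set
  Balanced T = ∀ {u v} → u ∉ T → v ∈ T → partSize T (c v) ≤ suc (partSize T (c u))

  Balanced-remove-largest : ∀ {R w} → w ∈ R → (∀ {v} → v ∈ R → partSize R (c v) ≤ partSize R (c w)) →
    Balanced R → Balanced (R - w)
  Balanced-remove-largest {R} {w} w∈R largest balanced {u} {v} u∉R-w v∈R-w with c u ≟ c w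
  ... | yes cu≡cw = begin
    partSize (R - w) (c v)        ≤⟨ partSize-mono-⊆ (p─q⊆p R ⁅ w ⁆) (c v) ⟩
    partSize R (c v)              ≤⟨ largest (p─q⊆p R ⁅ w ⁆ v∈R-w) ⟩
    partSize R (c w)              ≡⟨ partSize-removed-part w∈R ⟩
    suc (partSize (R - w) (c w))  ≡⟨ cong (suc ∘ partSize (R - w)) cu≡cw ⟨
    suc (partSize (R - w) (c u))  ∎
    where open ≤-Reasoning
  ... | no cu≢cw = begin
    partSize (R - w) (c v)        ≤⟨ partSize-mono-⊆ (p─q⊆p R ⁅ w ⁆) (c v) ⟩
    partSize R (c v)              ≤⟨ balanced u∉R (p─q⊆p R ⁅ w ⁆ v∈R-w) ⟩
    suc (partSize R (c u))        ≡⟨ cong suc (partSize-other-part w∈R (cu≢cw ∘ sym)) ⟩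
    suc (partSize (R - w) (c u))  ∎
    where
    open ≤-Reasoning
    u∉R : u ∉ R
    u∉R u∈R = u∉R-w (x∈p∧x≢y⇒x∈p-y u∈R (cu≢cw ∘ cong c))

  greedy-Balanced : ∀ {R us} → Greedy G R us → Balanced R → Balanced (R ─ toSubset us)
  greedy-Balanced {R} done balanced = subst Balanced (sym (p─⊥≡p R)) balanced
  greedy-Balanced {R} (step {u = w} {us} w∈R minDegree run) balanced =
    subst Balanced (p─q─r≡p─q∪r R ⁅ w ⁆ (toSubset us)) (greedy-Balanced run (Balanced-remove-largest w∈R
      (λ {v} v∈R → Equivalence.to (degIn-≤⇔partSize-≥ R w v) (minDegree v v∈R)) balanced))

  Balanced⇒sumSq-minimal : ∀ {T T' u₀} → Balanced T → u₀ ∉ T → ∣ T ∣ ≡ ∣ T' ∣ → sumSq T ≤ sumSq T'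
  Balanced⇒sumSq-minimal {T} {T'} {u₀} balanced u₀∉T ∣T∣≡∣T'∣
    with ∃-argmin (λ x → partSize T (c x)) {p = ∁ T} (u₀ , x∉p⇒x∈∁p u₀∉T)
  ... | u , u∈∁T , smallest =
    sumSq-threshold-≤ (partSize T) (partSize T') (partSize T (c u))
      (trans (sum-partSize T) (trans ∣T∣≡∣T'∣ (sym (sum-partSize T')))) below above
    where
    below : ∀ j → partSize T j < partSize T' j → partSize T (c u) ≤ partSize T j
    below j lt with sumOver-<⇒∃ {p = T} {T'} (λ x → δ (c x) j) lt
    ... | x , _ , x∉T , 0<δ =
      subst (λ i → partSize T (c u) ≤ partSize T i) (δ-pos⇒≡ 0<δ) (smallest (x∉p⇒x∈∁p x∉T))
    above : ∀ j → partSize T' j < partSize T j → partSize T j ≤ suc (partSize T (c u))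
    above j lt with sumOver-<⇒∃ {p = T'} {T} (λ x → δ (c x) j) lt
    ... | x , x∈T , _ , 0<δ =
      subst (λ i → partSize T i ≤ suc (partSize T (c u))) (δ-pos⇒≡ 0<δ) (balanced (x∈∁p⇒x∉p u∈∁T) x∈T)

  exchange-decreases-sumSq : ∀ {T u v} → u ∉ T → v ∈ T → suc (partSize T (c u)) < partSize T (c v) →
    sumSq ((T ∪ ⁅ u ⁆) - v) < sumSq T
  exchange-decreases-sumSq {T} {u} {v} u∉T v∈T gap = +-cancelʳ-< _ _ _ (begin-strict
    sumSq T' + suc (2 * m' (c v))                          ≡⟨ sumSq-bump m' (c v) ⟨
    sum (λ j → (m' j + δ (c v) j) * (m' j + δ (c v) j))  ≡⟨ sum-cong-≗ (λ j → cong (λ z → z * z) (swapped j)) ⟩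
    sum (λ j → (m j + δ (c u) j) * (m j + δ (c u) j))    ≡⟨ sumSq-bump m (c u) ⟩
    sumSq T + suc (2 * m (c u))                            <⟨ +-monoʳ-< (sumSq T) (s<s (*-monoʳ-< 2 m[cu]<m'[cv])) ⟩
    sumSq T + suc (2 * m' (c v))                           ∎)
    where
    open ≤-Reasoning
    T' : Subset n
    T' = (T ∪ ⁅ u ⁆) - v
    m m' : Fin k → ℕ
    m  = partSize T
    m' = partSize T'
    swapped : ∀ j → m' j + δ (c v) j ≡ m j + δ (c u) j
    swapped j = sumOver-swap (λ x → δ (c x) j) u∉T v∈T
    cu≢cv : c u ≢ c v
    cu≢cv cu≡cv = <-asym (subst (λ i → suc (m (c u)) < m i) (sym cu≡cv) gap) (n<1+n (m (c u)))
    m[cu]<m'[cv] : m (c u) < m' (c v)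
    m[cu]<m'[cv] = s≤s⁻¹ (begin
      suc (suc (m (c u)))     ≤⟨ gap ⟩
      m (c v)                 ≡⟨ +-identityʳ (m (c v)) ⟨
      m (c v) + 0             ≡⟨ cong (m (c v) +_) (δ-≢ cu≢cv) ⟨
      m (c v) + δ (c u) (c v) ≡⟨ swapped (c v) ⟨
      m' (c v) + δ (c v) (c v) ≡⟨ cong (m' (c v) +_) (δ-refl (c v)) ⟩
      m' (c v) + 1            ≡⟨ +-comm (m' (c v)) 1 ⟩
      suc (m' (c v))          ∎)

  sumSq-minimal⇒Balanced : ∀ {T} → (∀ {T'} → ∣ T' ∣ ≡ ∣ T ∣ → sumSq T ≤ sumSq T') → Balanced T
  sumSq-minimal⇒Balanced {T} minimal {u} {v} u∉T v∈T with partSize T (c v) ≤? suc (partSize T (c u))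
  ... | yes balanced = balanced
  ... | no  gap      = contradiction (minimal {(T ∪ ⁅ u ⁆) - v} (∣[p∪⁅u⁆]-v∣≡∣p∣ u∉T v∈T))
                                     (<⇒≱ (exchange-decreases-sumSq {T} u∉T v∈T (≰⇒> gap)))

  -- A kept v either shares its part with a deleted x, and then that part is no larger than w's,
  -- or its part is entirely kept, and then balance bounds it by the part of w.
  largest-part-of-union : ∀ {T D w} → Balanced T → (∀ {x} → x ∈ D → x ∉ T) → w ∈ D →
    (∀ {x} → x ∈ D → partSize (T ∪ D) (c x) ≤ partSize (T ∪ D) (c w)) →
    ∀ {v} → v ∈ T ∪ D → partSize (T ∪ D) (c v) ≤ partSize (T ∪ D) (c w)
  largest-part-of-union {T} {D} {w} balanced D∌T w∈D largest-in-D {v} v∈R with x∈p∪q⁻ T D v∈R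
  ... | inj₂ v∈D = largest-in-D v∈D
  ... | inj₁ v∈T with partSize (T ∪ D) (c v) ≤? partSize T (c v)
  ...   | yes R≤T = begin
    partSize R (c v)              ≤⟨ R≤T ⟩
    partSize T (c v)              ≤⟨ balanced (D∌T w∈D) v∈T ⟩
    suc (partSize T (c w))        ≤⟨ s≤s (partSize-mono-⊆ T⊆R-w (c w)) ⟩
    suc (partSize (R - w) (c w))  ≡⟨ partSize-removed-part w∈R ⟨
    partSize R (c w)              ∎
    where
    open ≤-Reasoning
    R : Subset n
    R = T ∪ D
    w∈R : w ∈ R
    w∈R = x∈p∪q⁺ (inj₂ w∈D)
    T⊆R-w : T ⊆ R - w
    T⊆R-w x∈T = x∈p∧x≢y⇒x∈p-y (x∈p∪q⁺ (inj₁ x∈T)) (λ { refl → D∌T w∈D x∈T })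
  ...   | no  R≰T with sumOver-<⇒∃ {p = T} {T ∪ D} (λ x → δ (c x) (c v)) (≰⇒> R≰T)
  ...     | x , x∈R , x∉T , 0<δ with x∈p∪q⁻ T D x∈R
  ...       | inj₁ x∈T = contradiction x∈T x∉T
  ...       | inj₂ x∈D =
    subst (λ j → partSize (T ∪ D) j ≤ partSize (T ∪ D) (c w)) (δ-pos⇒≡ 0<δ) (largest-in-D x∈D)

  Balanced⇒greedy : ∀ {T} → Balanced T → ∀ m {D} → ∣ D ∣ ≡ m → (∀ {x} → x ∈ D → x ∉ T) →
    ∃[ us ] length us ≡ m × Greedy G (T ∪ D) us × toSubset us ≡ D
  Balanced⇒greedy balanced zero ∣D∣≡0 _ = [] , refl , done , sym (∣p∣≡0⇒p≡⊥ ∣D∣≡0)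
  Balanced⇒greedy {T} balanced (suc m) {D} ∣D∣≡1+m D∌T
    with ∃-argmax (λ x → partSize (T ∪ D) (c x)) {D} (0<∣p∣⇒Nonempty (subst (0 <_) (sym ∣D∣≡1+m) z<s))
  ... | w , w∈D , largest-in-D
    with Balanced⇒greedy balanced m {D - w} (suc-injective (trans (sym (∣p∣≡1+∣p-x∣ w∈D)) ∣D∣≡1+m))
                                            (D∌T ∘ p─q⊆p D ⁅ w ⁆)
  ... | us , ∣us∣≡m , run , us≡D-w =
    w ∷ us , cong suc ∣us∣≡m ,
    step (x∈p∪q⁺ (inj₂ w∈D)) minDegree
         (subst (λ R → Greedy G R us) (sym ([p∪q]-x≡p∪[q-x] T D (D∌T w∈D))) run) ,
    trans (cong (⁅ w ⁆ ∪_) us≡D-w) (⁅x⁆∪[p-x]≡p w∈D)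
    where
    minDegree : ∀ v → v ∈ T ∪ D → degIn G (T ∪ D) w ≤ degIn G (T ∪ D) v
    minDegree v v∈R = Equivalence.from (degIn-≤⇔partSize-≥ (T ∪ D) w v)
                        (largest-part-of-union balanced D∌T w∈D largest-in-D v∈R)

  greedy-run-Balanced : ∀ {us S} → Greedy G ⊤ us → toSubset us ≡ S → Balanced (∁ S)
  greedy-run-Balanced {S = S} run us≡S = subst Balanced (trans (cong (⊤ ─_) us≡S) (⊤─p≡∁p S))
    (greedy-Balanced run (λ u∉⊤ → contradiction ∈⊤ u∉⊤))

  Balanced⇒greedy-run : ∀ {S} → Balanced (∁ S) → ∃[ us ] length us ≡ ∣ S ∣ × Greedy G ⊤ us × toSubset us ≡ S
  Balanced⇒greedy-run {S} balanced with Balanced⇒greedy balanced ∣ S ∣ {S} refl x∈p⇒x∉∁p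
  ... | us , ∣us∣≡∣S∣ , run , us≡S =
    us , ∣us∣≡∣S∣ , subst (λ R → Greedy G R us) (trans (∪-comm (∁ S) S) (p∪∁p≡⊤ S)) run , us≡S

  Balanced⇒edgesTouching-minimal : ∀ {S₀} → Balanced (∁ S₀) → Nonempty S₀ →
    ∀ S → ∣ S ∣ ≡ ∣ S₀ ∣ → edgesTouching G S₀ ≤ edgesTouching G S
  Balanced⇒edgesTouching-minimal {S₀} balanced (u₀ , u₀∈S₀) S ∣S∣≡∣S₀∣ =
    Equivalence.from (edgesTouching-≤⇔sumSq-≤ {S₀} {S} (sym ∣S∣≡∣S₀∣))
      (Balanced⇒sumSq-minimal {T' = ∁ S} balanced (x∈p⇒x∉∁p u₀∈S₀)
                                              (∣p∣≡∣q∣⇒∣∁p∣≡∣∁q∣ {p = S₀} {S} (sym ∣S∣≡∣S₀∣)))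

  edgesTouching-minimal⇒Balanced : ∀ {S₀} → (∀ S → ∣ S ∣ ≡ ∣ S₀ ∣ → edgesTouching G S₀ ≤ edgesTouching G S) →
    Balanced (∁ S₀)
  edgesTouching-minimal⇒Balanced {S₀} minimal = sumSq-minimal⇒Balanced (λ {T} → sumSq-minimal {T})
    where
    sumSq-minimal : ∀ {T} → ∣ T ∣ ≡ ∣ ∁ S₀ ∣ → sumSq (∁ S₀) ≤ sumSq T
    sumSq-minimal {T} ∣T∣≡∣∁S₀∣ = subst (λ T → sumSq (∁ S₀) ≤ sumSq T) (∁-involutive T)
      (Equivalence.to (edgesTouching-≤⇔sumSq-≤ {S₀} {∁ T} (sym ∣∁T∣≡∣S₀∣)) (minimal (∁ T) ∣∁T∣≡∣S₀∣))
      where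
      ∣∁T∣≡∣S₀∣ : ∣ ∁ T ∣ ≡ ∣ S₀ ∣
      ∣∁T∣≡∣S₀∣ = trans (∣p∣≡∣q∣⇒∣∁p∣≡∣∁q∣ {p = T} {∁ S₀} ∣T∣≡∣∁S₀∣) (cong ∣_∣ (∁-involutive S₀))

theorem5p2 : (n : ℕ) (G : Graph n) → IsCompleteMultipartite G →
    (r : ℕ) → 1 ≤ r → r ≤ n → (S₀ : Subset n) → ∣ S₀ ∣ ≡ r →
    (InPstar G r S₀ ⇔ (∀ (S : Subset n) → ∣ S ∣ ≡ r → edgesTouching G S₀ ≤ edgesTouching G S))
theorem5p2 n G (k , _ , c , _ , adj≡) r 1≤r _ S₀ ∣S₀∣≡r = mk⇔ greedy⇒minimum minimum⇒greedy
  where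
  open CompleteMultipartite G c adj≡

  greedy⇒minimum : InPstar G r S₀ → ∀ S → ∣ S ∣ ≡ r → edgesTouching G S₀ ≤ edgesTouching G S
  greedy⇒minimum (us , _ , run , us≡S₀) S ∣S∣≡r =
    Balanced⇒edgesTouching-minimal (greedy-run-Balanced run us≡S₀)
      (0<∣p∣⇒Nonempty (subst (0 <_) (sym ∣S₀∣≡r) 1≤r)) S (trans ∣S∣≡r (sym ∣S₀∣≡r))

  minimum⇒greedy : (∀ S → ∣ S ∣ ≡ r → edgesTouching G S₀ ≤ edgesTouching G S) → InPstar G r S₀
  minimum⇒greedy minimum =
    let us , ∣us∣≡∣S₀∣ , run , us≡S₀ = Balanced⇒greedy-run (edgesTouching-minimal⇒Balanced
                                          (λ S ∣S∣≡∣S₀∣ → minimum S (trans ∣S∣≡∣S₀∣ ∣S₀∣≡r)))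
    in us , trans ∣us∣≡∣S₀∣ ∣S₀∣≡r , run , us≡S₀
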